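{- For all integers $n\geq0$, \[ \sum_{j=0}^n\binom{2(n-j)}{n-j}C_jO_{n-j} = \frac12\binom{2(n+1)}{n+1}O_{n+1} - \frac{4^n}{n+1}. \]
   Context: $O_n=\sum_{j=1}^n\frac{1}{2j-1}$ (with $O_0=0$) and $C_n=\frac1{n+1}\binom{2n}{n}$ is the $n$th Catalan number. -}

module Defs where

open import Data.Nat using (ℕ; zero; suc; _∸_; _^_) renaming (_*_ to _*ℕ_)
open import Data.Nat.Combinatorics using (_C_)
open import Data.Integer using (+_)
open import Data.Rational using (ℚ; _/_; _+_; _*_; 0ℚ)

ℕ→ℚ : ℕ → ℚ
ℕ→ℚ n = (+ n) / 1

O : ℕ → ℚ
O zero = 0ℚ
O (suc n) = O n + (+ 1) / (suc (2 *ℕ n))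

catalan : ℕ → ℚ
catalan n = (+ ((2 *ℕ n) C n)) / suc n

sumTo : ℕ → (ℕ → ℚ) → ℚ
sumTo zero f = f 0
sumTo (suc n) f = sumTo n f + f (suc n)

-- Write b k for the central binomial coefficient (2k choose k) and ρ k = 2(2k+1) (centralRatio).
-- Then (k+2) C (k+1) = ρ k · C k and (k+1) b (k+1) = ρ k · b k, and since O (k+1) = O k + 1/(2k+1),
-- also (k+1) (b O) (k+1) = ρ k · (b O) k + 2 b k. In the convolution Σ C j · d (n+1-j) the weight
-- n+2 splits as (j+1) + (n+1-j), one part for each factor; for d of this kind both parts can be
-- shifted down by these recurrences, and as ρ i + ρ (n-i) = 4(n+1) the convolution satisfies a
-- first-order recurrence in n. The claimed closed forms b (n+1)/2 (for d = b) and
-- b (n+1) O (n+1)/2 - 4^n/(n+1) (for d = b O) satisfy the same recurrences and initial values.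

module Submission where

open import Function using (_∘_; _$_; id)
open import Relation.Nullary.Decidable using (dec⇒maybe)
open import Level using (0ℓ)
open import Data.Nat as ℕ using (ℕ; zero; suc; _∸_; _^_; _≤_; z≤n; _!)
import Data.Nat.Properties as ℕ
open import Data.Nat.Properties using (_!*_!≢0)
open import Data.Nat.Combinatorics using (_C_; k![n∸k]!∣n!)
open import Data.Nat.Combinatorics.Specification using (nCk≡n!/k![n-k]!)
open import Data.Nat.DivMod using (m/n*n≡m)
open import Data.Nat.Tactic.RingSolver using () renaming (solve-∀ to ℕ-solve-∀)
open import Data.Integer as ℤ using (+_)
import Data.Integer.Properties as ℤ
open import Data.Rational using (ℚ; _/_; _+_; _-_; _*_; ½; 0ℚ; 1ℚ; fromℚᵘ)
open import Data.Rational.Properties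
open import Data.Rational.Unnormalised as ℚᵘ using (ℚᵘ; mkℚᵘ; *≡*)
import Data.Rational.Unnormalised.Properties as ℚᵘ
open import Relation.Binary.PropositionalEquality
open ≡-Reasoning
open import Tactic.RingSolver using (solve-∀)
open import Tactic.RingSolver.Core.AlmostCommutativeRing using (AlmostCommutativeRing; fromCommutativeRing)

open import Defs

nCk*k![n∸k]!≡n! : ∀ {n k} → k ≤ n → (n C k) ℕ.* (k ! ℕ.* (n ∸ k) !) ≡ n !
nCk*k![n∸k]!≡n! {n} {k} k≤n =
  trans (cong (ℕ._* (k ! ℕ.* (n ∸ k) !)) (nCk≡n!/k![n-k]! k≤n))
        (m/n*n≡m {{k !* (n ∸ k) !≢0}} (k![n∸k]!∣n! k≤n))

centralBinomial : ℕ → ℕ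
centralBinomial k = (2 ℕ.* k) C k

centralBinomial*k!*k!≡[2k]! : ∀ k → centralBinomial k ℕ.* (k ! ℕ.* k !) ≡ (2 ℕ.* k) !
centralBinomial*k!*k!≡[2k]! k = begin
  centralBinomial k ℕ.* (k ! ℕ.* k !)              ≡⟨ cong (λ m → centralBinomial k ℕ.* (k ! ℕ.* m !)) 2k∸k≡k ⟨
  centralBinomial k ℕ.* (k ! ℕ.* (2 ℕ.* k ∸ k) !)  ≡⟨ nCk*k![n∸k]!≡n! (ℕ.m≤m+n k (k ℕ.+ 0)) ⟩
  (2 ℕ.* k) !                                      ∎
  where
  -- 2 * k unfolds to k + (k + 0)
  2k∸k≡k : 2 ℕ.* k ∸ k ≡ k
  2k∸k≡k = trans (ℕ.m+n∸m≡n k (k ℕ.+ 0)) (ℕ.+-identityʳ k)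

centralRatio : ℕ → ℕ
centralRatio k = 2 ℕ.* suc (2 ℕ.* k)

centralBinomial-suc : ∀ k → suc k ℕ.* centralBinomial (suc k) ≡ centralRatio k ℕ.* centralBinomial k
centralBinomial-suc k =
  ℕ.*-cancelʳ-≡ _ _ (suc k ℕ.* (k ! ℕ.* k !)) {{ℕ.m*n≢0 (suc k) _ {{_}} {{k !* k !≢0}}}} $ begin
  suc k ℕ.* b₁ ℕ.* (suc k ℕ.* (k ! ℕ.* k !))  ≡⟨ regroup (suc k) b₁ (k !) ⟩
  b₁ ℕ.* (suc k ! ℕ.* suc k !)                 ≡⟨ centralBinomial*k!*k!≡[2k]! (suc k) ⟩
  (2 ℕ.* suc k) !                              ≡⟨ cong _! (ℕ.*-distribˡ-+ 2 1 k) ⟩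
  suc (suc (2 ℕ.* k)) !
    ≡⟨ cong (λ m → (2 ℕ.+ 2 ℕ.* k) ℕ.* (suc (2 ℕ.* k) ℕ.* m)) (centralBinomial*k!*k!≡[2k]! k) ⟨
  (2 ℕ.+ 2 ℕ.* k) ℕ.* (suc (2 ℕ.* k) ℕ.* (b₀ ℕ.* (k ! ℕ.* k !)))
    ≡⟨ regroup′ k b₀ (k ! ℕ.* k !) ⟩
  2 ℕ.* suc (2 ℕ.* k) ℕ.* b₀ ℕ.* (suc k ℕ.* (k ! ℕ.* k !)) ∎
  where
  b₀ b₁ : ℕ
  b₀ = centralBinomial k
  b₁ = centralBinomial (suc k)
  regroup : ∀ a b f → a ℕ.* b ℕ.* (a ℕ.* (f ℕ.* f)) ≡ b ℕ.* (a ℕ.* f ℕ.* (a ℕ.* f))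
  regroup = ℕ-solve-∀
  regroup′ : ∀ k b g → (2 ℕ.+ 2 ℕ.* k) ℕ.* (suc (2 ℕ.* k) ℕ.* (b ℕ.* g))
                      ≡ 2 ℕ.* suc (2 ℕ.* k) ℕ.* b ℕ.* (suc k ℕ.* g)
  regroup′ = ℕ-solve-∀

ℚ-ring : AlmostCommutativeRing 0ℓ 0ℓ
ℚ-ring = fromCommutativeRing +-*-commutativeRing (λ x → dec⇒maybe (0ℚ ≟ x))

fromℚᵘ-homo-+ : ∀ p q → fromℚᵘ (p ℚᵘ.+ q) ≡ fromℚᵘ p + fromℚᵘ q
fromℚᵘ-homo-+ p q = toℚᵘ-injective (ℚᵘ.≃-trans (toℚᵘ-fromℚᵘ (p ℚᵘ.+ q))
  (ℚᵘ.≃-sym (ℚᵘ.≃-trans (toℚᵘ-homo-+ (fromℚᵘ p) (fromℚᵘ q)) (ℚᵘ.+-cong (toℚᵘ-fromℚᵘ p) (toℚᵘ-fromℚᵘ q)))))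

fromℚᵘ-homo-* : ∀ p q → fromℚᵘ (p ℚᵘ.* q) ≡ fromℚᵘ p * fromℚᵘ q
fromℚᵘ-homo-* p q = toℚᵘ-injective (ℚᵘ.≃-trans (toℚᵘ-fromℚᵘ (p ℚᵘ.* q))
  (ℚᵘ.≃-sym (ℚᵘ.≃-trans (toℚᵘ-homo-* (fromℚᵘ p) (fromℚᵘ q)) (ℚᵘ.*-cong (toℚᵘ-fromℚᵘ p) (toℚᵘ-fromℚᵘ q)))))

ℕ→ℚᵘ : ℕ → ℚᵘ
ℕ→ℚᵘ n = mkℚᵘ (+ n) 0

ℕ→ℚ-homo-+ : ∀ m n → ℕ→ℚ (m ℕ.+ n) ≡ ℕ→ℚ m + ℕ→ℚ n
ℕ→ℚ-homo-+ m n =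
  trans (fromℚᵘ-cong {ℕ→ℚᵘ (m ℕ.+ n)} {ℕ→ℚᵘ m ℚᵘ.+ ℕ→ℚᵘ n} (*≡* eq)) (fromℚᵘ-homo-+ (ℕ→ℚᵘ m) (ℕ→ℚᵘ n))
  where
  eq : + (m ℕ.+ n) ℤ.* + 1 ≡ (+ m ℤ.* + 1 ℤ.+ + n ℤ.* + 1) ℤ.* + 1
  eq = cong (ℤ._* + 1) (sym (cong₂ ℤ._+_ (ℤ.*-identityʳ (+ m)) (ℤ.*-identityʳ (+ n))))

ℕ→ℚ-homo-* : ∀ m n → ℕ→ℚ (m ℕ.* n) ≡ ℕ→ℚ m * ℕ→ℚ n
ℕ→ℚ-homo-* m n =
  trans (fromℚᵘ-cong {ℕ→ℚᵘ (m ℕ.* n)} {ℕ→ℚᵘ m ℚᵘ.* ℕ→ℚᵘ n} (*≡* (cong (ℤ._* + 1) (ℤ.pos-* m n))))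
        (fromℚᵘ-homo-* (ℕ→ℚᵘ m) (ℕ→ℚᵘ n))

a/n*n≡a : ∀ a m → (+ a / suc m) * ℕ→ℚ (suc m) ≡ ℕ→ℚ a
a/n*n≡a a m = trans (sym (fromℚᵘ-homo-* (mkℚᵘ (+ a) m) (ℕ→ℚᵘ (suc m))))
                    (fromℚᵘ-cong {mkℚᵘ (+ a) m ℚᵘ.* ℕ→ℚᵘ (suc m)} {ℕ→ℚᵘ a} (*≡* eq))
  where
  eq : (+ a ℤ.* + suc m) ℤ.* + 1 ≡ + a ℤ.* + (suc m ℕ.* 1)
  eq = trans (ℤ.*-identityʳ _) (cong (λ z → + a ℤ.* + z) (sym (ℕ.*-identityʳ (suc m))))

*-cancelˡ-suc : ∀ m {x y} → ℕ→ℚ (suc m) * x ≡ ℕ→ℚ (suc m) * y → x ≡ y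
*-cancelˡ-suc m {x} {y} eq = trans (sym (undo x)) (trans (cong ((+ 1 / suc m) *_) eq) (undo y))
  where
  undo : ∀ z → (+ 1 / suc m) * (ℕ→ℚ (suc m) * z) ≡ z
  undo z = trans (sym (*-assoc (+ 1 / suc m) (ℕ→ℚ (suc m)) z))
                 (trans (cong (_* z) (a/n*n≡a 1 m)) (*-identityˡ z))

centralRatio-suc : ∀ n → ℕ→ℚ (centralRatio (suc n)) ≡ ℕ→ℚ (4 ℕ.* suc n) + ℕ→ℚ 2
centralRatio-suc n = trans (cong ℕ→ℚ (formula n)) (ℕ→ℚ-homo-+ (4 ℕ.* suc n) 2)
  where
  formula : ∀ n → 2 ℕ.* suc (2 ℕ.* suc n) ≡ 4 ℕ.* suc n ℕ.+ 2
  formula = ℕ-solve-∀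

recurrence-unique : ∀ (F : ℕ → ℚ → ℚ) {f g : ℕ → ℚ} → f 0 ≡ g 0 →
  (∀ n → ℕ→ℚ (2 ℕ.+ n) * f (suc n) ≡ F n (f n)) →
  (∀ n → ℕ→ℚ (2 ℕ.+ n) * g (suc n) ≡ F n (g n)) →
  ∀ n → f n ≡ g n
recurrence-unique F         f₀≡g₀ f-rec g-rec zero    = f₀≡g₀
recurrence-unique F {f} {g} f₀≡g₀ f-rec g-rec (suc n) = *-cancelˡ-suc (suc n) (begin
  ℕ→ℚ (2 ℕ.+ n) * f (suc n)  ≡⟨ f-rec n ⟩
  F n (f n)                  ≡⟨ cong (F n) (recurrence-unique F f₀≡g₀ f-rec g-rec n) ⟩
  F n (g n)                  ≡⟨ g-rec n ⟨
  ℕ→ℚ (2 ℕ.+ n) * g (suc n)  ∎)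

sumTo-cong : ∀ n {f g : ℕ → ℚ} → (∀ {j} → j ≤ n → f j ≡ g j) → sumTo n f ≡ sumTo n g
sumTo-cong zero    f≗g = f≗g z≤n
sumTo-cong (suc n) f≗g = cong₂ _+_ (sumTo-cong n (f≗g ∘ ℕ.m≤n⇒m≤1+n)) (f≗g ℕ.≤-refl)

sumTo-+ : ∀ n (f g : ℕ → ℚ) → sumTo n (λ j → f j + g j) ≡ sumTo n f + sumTo n g
sumTo-+ zero    f g = refl
sumTo-+ (suc n) f g = trans (cong (_+ (f (suc n) + g (suc n))) (sumTo-+ n f g))
                            (interchange (sumTo n f) (sumTo n g) (f (suc n)) (g (suc n)))
  where
  interchange : ∀ a b c d → a + b + (c + d) ≡ a + c + (b + d)
  interchange = solve-∀ ℚ-ring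

sumTo-*ˡ : ∀ n a (f : ℕ → ℚ) → sumTo n (λ j → a * f j) ≡ a * sumTo n f
sumTo-*ˡ zero    a f = refl
sumTo-*ˡ (suc n) a f = trans (cong (_+ a * f (suc n)) (sumTo-*ˡ n a f))
                             (sym (*-distribˡ-+ a (sumTo n f) (f (suc n))))

sumTo-sucˡ : ∀ n (f : ℕ → ℚ) → sumTo (suc n) f ≡ f 0 + sumTo n (f ∘ suc)
sumTo-sucˡ zero    f = refl
sumTo-sucˡ (suc n) f = trans (cong (_+ f (suc (suc n))) (sumTo-sucˡ n f)) (+-assoc (f 0) _ _)

sumTo-zero : ∀ n → sumTo n (λ _ → 0ℚ) ≡ 0ℚ
sumTo-zero zero    = refl
sumTo-zero (suc n) = trans (+-identityʳ _) (sumTo-zero n)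

infixl 7 _⋆_

_⋆_ : (ℕ → ℚ) → (ℕ → ℚ) → ℕ → ℚ
(c ⋆ d) n = sumTo n (λ j → c j * d (n ∸ j))

⋆-cong : ∀ {c c′ d d′ : ℕ → ℚ} → (∀ i → c i ≡ c′ i) → (∀ k → d k ≡ d′ k) →
         ∀ n → (c ⋆ d) n ≡ (c′ ⋆ d′) n
⋆-cong c≗c′ d≗d′ n = sumTo-cong n (λ {j} _ → cong₂ _*_ (c≗c′ j) (d≗d′ (n ∸ j)))

⋆-distribˡ-+ : ∀ (c d e : ℕ → ℚ) n → (c ⋆ (λ k → d k + e k)) n ≡ (c ⋆ d) n + (c ⋆ e) n
⋆-distribˡ-+ c d e n =
  trans (sumTo-cong n (λ {j} _ → *-distribˡ-+ (c j) (d (n ∸ j)) (e (n ∸ j)))) (sumTo-+ n _ _)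

⋆-*ʳ : ∀ (c d : ℕ → ℚ) a n → (c ⋆ (λ k → a * d k)) n ≡ a * (c ⋆ d) n
⋆-*ʳ c d a n = trans (sumTo-cong n (λ {j} _ → swap (c j) a (d (n ∸ j)))) (sumTo-*ˡ n a _)
  where
  swap : ∀ x y z → x * (y * z) ≡ y * (x * z)
  swap = solve-∀ ℚ-ring

⋆-zeroʳ : ∀ (c : ℕ → ℚ) n → (c ⋆ (λ _ → 0ℚ)) n ≡ 0ℚ
⋆-zeroʳ c n = trans (sumTo-cong n (λ {j} _ → *-zeroʳ (c j))) (sumTo-zero n)

⋆-sucˡ : ∀ (c d : ℕ → ℚ) n → (c ⋆ d) (suc n) ≡ c 0 * d (suc n) + ((c ∘ suc) ⋆ d) n
⋆-sucˡ c d n = sumTo-sucˡ n _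

⋆-sucʳ : ∀ (c d : ℕ → ℚ) n → (c ⋆ d) (suc n) ≡ (c ⋆ (d ∘ suc)) n + c (suc n) * d 0
⋆-sucʳ c d n = cong₂ _+_
  (sumTo-cong n (λ {j} j≤n → cong (λ m → c j * d m) (ℕ.+-∸-assoc 1 j≤n)))
  (cong (λ m → c (suc n) * d m) (ℕ.n∸n≡0 n))

⋆-weighted : ∀ (u v : ℕ → ℕ) {n w} → (∀ {i} → i ≤ n → u i ℕ.+ v (n ∸ i) ≡ w) → ∀ c d →
  ℕ→ℚ w * (c ⋆ d) n ≡ ((λ i → ℕ→ℚ (u i) * c i) ⋆ d) n + (c ⋆ (λ k → ℕ→ℚ (v k) * d k)) n
⋆-weighted u v {n} {w} u+v≡w c d = begin
  ℕ→ℚ w * (c ⋆ d) n                            ≡⟨ sumTo-*ˡ n (ℕ→ℚ w) (λ j → c j * d (n ∸ j)) ⟨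
  sumTo n (λ j → ℕ→ℚ w * (c j * d (n ∸ j)))    ≡⟨ sumTo-cong n split ⟩
  sumTo n (λ j → ℕ→ℚ (u j) * c j * d (n ∸ j) + c j * (ℕ→ℚ (v (n ∸ j)) * d (n ∸ j)))
                                               ≡⟨ sumTo-+ n _ _ ⟩
  _                                            ∎
  where
  distrib : ∀ x y a b → (x + y) * (a * b) ≡ x * a * b + a * (y * b)
  distrib = solve-∀ ℚ-ring
  split : ∀ {j} → j ≤ n →
          ℕ→ℚ w * (c j * d (n ∸ j)) ≡ ℕ→ℚ (u j) * c j * d (n ∸ j) + c j * (ℕ→ℚ (v (n ∸ j)) * d (n ∸ j))
  split {j} j≤n = begin
    ℕ→ℚ w * (c j * d (n ∸ j))                          ≡⟨ cong (λ m → ℕ→ℚ m * _) (u+v≡w j≤n) ⟨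
    ℕ→ℚ (u j ℕ.+ v (n ∸ j)) * (c j * d (n ∸ j))        ≡⟨ cong (_* _) (ℕ→ℚ-homo-+ (u j) (v (n ∸ j))) ⟩
    (ℕ→ℚ (u j) + ℕ→ℚ (v (n ∸ j))) * (c j * d (n ∸ j))
      ≡⟨ distrib (ℕ→ℚ (u j)) (ℕ→ℚ (v (n ∸ j))) (c j) (d (n ∸ j)) ⟩
    _ ∎

⋆-recurrence : ∀ {c d e : ℕ → ℚ} → c 0 ≡ 1ℚ →
  (∀ i → ℕ→ℚ (2 ℕ.+ i) * c (suc i) ≡ ℕ→ℚ (centralRatio i) * c i) →
  (∀ k → ℕ→ℚ (suc k) * d (suc k) ≡ ℕ→ℚ (centralRatio k) * d k + e k) →
  ∀ n → ℕ→ℚ (2 ℕ.+ n) * (c ⋆ d) (suc n) ≡ ℕ→ℚ (4 ℕ.* suc n) * (c ⋆ d) n + (c ⋆ e) n + d (suc n)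
⋆-recurrence {c} {d} {e} c₀≡1 c-rec d-rec n = begin
  ℕ→ℚ (2 ℕ.+ n) * (c ⋆ d) (suc n)
    ≡⟨ ⋆-weighted suc id {suc n} (cong suc ∘ ℕ.m+[n∸m]≡n) c d ⟩
  (sc ⋆ d) (suc n) + (c ⋆ kd) (suc n)
    ≡⟨ cong₂ _+_ (⋆-sucˡ sc d n) (⋆-sucʳ c kd n) ⟩
  (sc 0 * d (suc n) + ((sc ∘ suc) ⋆ d) n) + ((c ⋆ (kd ∘ suc)) n + c (suc n) * kd 0)
    ≡⟨ cong₂ (λ x y → (sc 0 * d (suc n) + x) + (y + c (suc n) * kd 0))
             (⋆-cong {c′ = rc} {d} c-rec (λ _ → refl) n)
             (trans (⋆-cong {c} {d′ = λ k → rd k + e k} (λ _ → refl) d-rec n) (⋆-distribˡ-+ c rd e n)) ⟩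
  (sc 0 * d (suc n) + (rc ⋆ d) n) + ((c ⋆ rd) n + (c ⋆ e) n + c (suc n) * kd 0)
    ≡⟨ cong₂ (λ x y → (x + (rc ⋆ d) n) + ((c ⋆ rd) n + (c ⋆ e) n + y)) head tail ⟩
  (d (suc n) + (rc ⋆ d) n) + ((c ⋆ rd) n + (c ⋆ e) n + 0ℚ)
    ≡⟨ regroup (d (suc n)) ((rc ⋆ d) n) ((c ⋆ rd) n) ((c ⋆ e) n) ⟩
  (rc ⋆ d) n + (c ⋆ rd) n + (c ⋆ e) n + d (suc n)
    ≡⟨ cong (λ x → x + (c ⋆ e) n + d (suc n)) (⋆-weighted centralRatio centralRatio ratio-sum c d) ⟨
  ℕ→ℚ (4 ℕ.* suc n) * (c ⋆ d) n + (c ⋆ e) n + d (suc n) ∎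
  where
  sc rc kd rd : ℕ → ℚ
  sc i = ℕ→ℚ (suc i) * c i
  rc i = ℕ→ℚ (centralRatio i) * c i
  kd k = ℕ→ℚ k * d k
  rd k = ℕ→ℚ (centralRatio k) * d k
  head : sc 0 * d (suc n) ≡ d (suc n)
  head = trans (cong (λ γ → ℕ→ℚ 1 * γ * d (suc n)) c₀≡1) (*-identityˡ (d (suc n)))
  tail : c (suc n) * kd 0 ≡ 0ℚ
  tail = trans (cong (c (suc n) *_) (*-zeroˡ (d 0))) (*-zeroʳ (c (suc n)))
  regroup : ∀ x a b c → (x + a) + (b + c + 0ℚ) ≡ a + b + c + x
  regroup = solve-∀ ℚ-ring
  ratio-sum : ∀ {i} → i ≤ n → centralRatio i ℕ.+ centralRatio (n ∸ i) ≡ 4 ℕ.* suc n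
  ratio-sum {i} i≤n = trans (sum-formula i (n ∸ i)) (cong (λ m → 4 ℕ.* suc m) (ℕ.m+[n∸m]≡n i≤n))
    where
    sum-formula : ∀ i m → 2 ℕ.* suc (2 ℕ.* i) ℕ.+ 2 ℕ.* suc (2 ℕ.* m) ≡ 4 ℕ.* suc (i ℕ.+ m)
    sum-formula = ℕ-solve-∀

centralBinomialℚ : ℕ → ℚ
centralBinomialℚ k = ℕ→ℚ (centralBinomial k)

centralBinomialℚ-suc : ∀ k →
  ℕ→ℚ (suc k) * centralBinomialℚ (suc k) ≡ ℕ→ℚ (centralRatio k) * centralBinomialℚ k
centralBinomialℚ-suc k = begin
  ℕ→ℚ (suc k) * centralBinomialℚ (suc k)                   ≡⟨ ℕ→ℚ-homo-* (suc k) (centralBinomial (suc k)) ⟨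
  ℕ→ℚ (suc k ℕ.* centralBinomial (suc k))                  ≡⟨ cong ℕ→ℚ (centralBinomial-suc k) ⟩
  ℕ→ℚ (centralRatio k ℕ.* centralBinomial k)               ≡⟨ ℕ→ℚ-homo-* (centralRatio k) (centralBinomial k) ⟩
  ℕ→ℚ (centralRatio k) * centralBinomialℚ k                ∎

catalan*[1+n]≡centralBinomialℚ : ∀ n → catalan n * ℕ→ℚ (suc n) ≡ centralBinomialℚ n
catalan*[1+n]≡centralBinomialℚ n = a/n*n≡a (centralBinomial n) n

catalan-suc : ∀ i → ℕ→ℚ (2 ℕ.+ i) * catalan (suc i) ≡ ℕ→ℚ (centralRatio i) * catalan i
catalan-suc i = *-cancelˡ-suc i (begin
  ℕ→ℚ (suc i) * (ℕ→ℚ (2 ℕ.+ i) * catalan (suc i))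
    ≡⟨ cong (ℕ→ℚ (suc i) *_) (trans (*-comm (ℕ→ℚ (2 ℕ.+ i)) _) (catalan*[1+n]≡centralBinomialℚ (suc i))) ⟩
  ℕ→ℚ (suc i) * centralBinomialℚ (suc i)
    ≡⟨ centralBinomialℚ-suc i ⟩
  ℕ→ℚ (centralRatio i) * centralBinomialℚ i
    ≡⟨ cong (ℕ→ℚ (centralRatio i) *_) (catalan*[1+n]≡centralBinomialℚ i) ⟨
  ℕ→ℚ (centralRatio i) * (catalan i * ℕ→ℚ (suc i))
    ≡⟨ rotate (ℕ→ℚ (centralRatio i)) (catalan i) (ℕ→ℚ (suc i)) ⟩
  ℕ→ℚ (suc i) * (ℕ→ℚ (centralRatio i) * catalan i) ∎)
  where
  rotate : ∀ x y z → x * (y * z) ≡ z * (x * y)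
  rotate = solve-∀ ℚ-ring

catalan⋆centralBinomialℚ : ∀ n → (catalan ⋆ centralBinomialℚ) n ≡ ½ * centralBinomialℚ (suc n)
catalan⋆centralBinomialℚ =
  recurrence-unique (λ n x → ℕ→ℚ (4 ℕ.* suc n) * x + B (suc n)) refl convolution-rec closed-rec
  where
  B : ℕ → ℚ
  B = centralBinomialℚ
  convolution-rec : ∀ n →
    ℕ→ℚ (2 ℕ.+ n) * (catalan ⋆ B) (suc n) ≡ ℕ→ℚ (4 ℕ.* suc n) * (catalan ⋆ B) n + B (suc n)
  convolution-rec n = begin
    ℕ→ℚ (2 ℕ.+ n) * (catalan ⋆ B) (suc n)
      ≡⟨ ⋆-recurrence refl catalan-suc
           (λ k → trans (centralBinomialℚ-suc k) (sym (+-identityʳ (ℕ→ℚ (centralRatio k) * B k)))) n ⟩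
    ℕ→ℚ (4 ℕ.* suc n) * (catalan ⋆ B) n + (catalan ⋆ (λ _ → 0ℚ)) n + B (suc n)
      ≡⟨ cong (λ x → ℕ→ℚ (4 ℕ.* suc n) * (catalan ⋆ B) n + x + B (suc n)) (⋆-zeroʳ catalan n) ⟩
    ℕ→ℚ (4 ℕ.* suc n) * (catalan ⋆ B) n + 0ℚ + B (suc n)
      ≡⟨ cong (_+ B (suc n)) (+-identityʳ (ℕ→ℚ (4 ℕ.* suc n) * (catalan ⋆ B) n)) ⟩
    ℕ→ℚ (4 ℕ.* suc n) * (catalan ⋆ B) n + B (suc n) ∎
  closed-rec : ∀ n →
    ℕ→ℚ (2 ℕ.+ n) * (½ * B (2 ℕ.+ n)) ≡ ℕ→ℚ (4 ℕ.* suc n) * (½ * B (suc n)) + B (suc n)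
  closed-rec n = begin
    ℕ→ℚ (2 ℕ.+ n) * (½ * B (2 ℕ.+ n))              ≡⟨ x∙yz≈y∙xz (ℕ→ℚ (2 ℕ.+ n)) ½ (B (2 ℕ.+ n)) ⟩
    ½ * (ℕ→ℚ (2 ℕ.+ n) * B (2 ℕ.+ n))              ≡⟨ cong (½ *_) (centralBinomialℚ-suc (suc n)) ⟩
    ½ * (ℕ→ℚ (centralRatio (suc n)) * B (suc n))   ≡⟨ cong (λ x → ½ * (x * B (suc n))) (centralRatio-suc n) ⟩
    ½ * ((ℕ→ℚ (4 ℕ.* suc n) + ℕ→ℚ 2) * B (suc n))  ≡⟨ halve (ℕ→ℚ (4 ℕ.* suc n)) (B (suc n)) ⟩
    ℕ→ℚ (4 ℕ.* suc n) * (½ * B (suc n)) + B (suc n) ∎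
    where
    x∙yz≈y∙xz : ∀ x y z → x * (y * z) ≡ y * (x * z)
    x∙yz≈y∙xz = solve-∀ ℚ-ring
    halve : ∀ a b → ½ * ((a + ℕ→ℚ 2) * b) ≡ a * (½ * b) + b
    halve = solve-∀ ℚ-ring

centralBinomialO : ℕ → ℚ
centralBinomialO k = centralBinomialℚ k * O k

centralBinomialO-suc : ∀ k → ℕ→ℚ (suc k) * centralBinomialO (suc k)
                             ≡ ℕ→ℚ (centralRatio k) * centralBinomialO k + ℕ→ℚ 2 * centralBinomialℚ k
centralBinomialO-suc k = begin
  ℕ→ℚ (suc k) * (B (suc k) * (O k + t))                 ≡⟨ *-assoc (ℕ→ℚ (suc k)) (B (suc k)) (O k + t) ⟨
  ℕ→ℚ (suc k) * B (suc k) * (O k + t)                   ≡⟨ cong (_* (O k + t)) (centralBinomialℚ-suc k) ⟩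
  ℕ→ℚ (2 ℕ.* s) * B k * (O k + t)                       ≡⟨ cong (λ x → x * B k * (O k + t)) (ℕ→ℚ-homo-* 2 s) ⟩
  ℕ→ℚ 2 * ℕ→ℚ s * B k * (O k + t)                       ≡⟨ expand (ℕ→ℚ 2) (ℕ→ℚ s) (B k) (O k) t ⟩
  ℕ→ℚ 2 * ℕ→ℚ s * (B k * O k) + ℕ→ℚ 2 * B k * (t * ℕ→ℚ s)
    ≡⟨ cong₂ (λ x y → x * centralBinomialO k + ℕ→ℚ 2 * B k * y) (sym (ℕ→ℚ-homo-* 2 s)) (a/n*n≡a 1 (2 ℕ.* k)) ⟩
  ℕ→ℚ (2 ℕ.* s) * centralBinomialO k + ℕ→ℚ 2 * B k * 1ℚ
    ≡⟨ cong (_+_ (ℕ→ℚ (2 ℕ.* s) * centralBinomialO k)) (*-identityʳ (ℕ→ℚ 2 * B k)) ⟩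
  ℕ→ℚ (2 ℕ.* s) * centralBinomialO k + ℕ→ℚ 2 * B k      ∎
  where
  B : ℕ → ℚ
  B = centralBinomialℚ
  s : ℕ
  s = suc (2 ℕ.* k)
  t : ℚ
  t = + 1 / s
  expand : ∀ a x b o t → a * x * b * (o + t) ≡ a * x * (b * o) + a * b * (t * x)
  expand = solve-∀ ℚ-ring

4^n/[1+n]-rec : ∀ n →
  ℕ→ℚ (2 ℕ.+ n) * (+ (4 ^ suc n) / suc (suc n)) ≡ ℕ→ℚ (4 ℕ.* suc n) * (+ (4 ^ n) / suc n)
4^n/[1+n]-rec n = begin
  ℕ→ℚ (2 ℕ.+ n) * (+ (4 ^ suc n) / suc (suc n))   ≡⟨ *-comm (ℕ→ℚ (2 ℕ.+ n)) _ ⟩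
  (+ (4 ^ suc n) / suc (suc n)) * ℕ→ℚ (2 ℕ.+ n)   ≡⟨ a/n*n≡a (4 ^ suc n) (suc n) ⟩
  ℕ→ℚ (4 ℕ.* 4 ^ n)                               ≡⟨ ℕ→ℚ-homo-* 4 (4 ^ n) ⟩
  ℕ→ℚ 4 * ℕ→ℚ (4 ^ n)                             ≡⟨ cong (ℕ→ℚ 4 *_) (a/n*n≡a (4 ^ n) n) ⟨
  ℕ→ℚ 4 * ((+ (4 ^ n) / suc n) * ℕ→ℚ (suc n))     ≡⟨ reorder (ℕ→ℚ 4) _ (ℕ→ℚ (suc n)) ⟩
  ℕ→ℚ 4 * ℕ→ℚ (suc n) * (+ (4 ^ n) / suc n)       ≡⟨ cong (_* (+ (4 ^ n) / suc n)) (ℕ→ℚ-homo-* 4 (suc n)) ⟨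
  ℕ→ℚ (4 ℕ.* suc n) * (+ (4 ^ n) / suc n)         ∎
  where
  reorder : ∀ a p m → a * (p * m) ≡ a * m * p
  reorder = solve-∀ ℚ-ring

catalan⋆centralBinomialO : ∀ n →
  (catalan ⋆ centralBinomialO) n ≡ ½ * centralBinomialO (suc n) - + (4 ^ n) / suc n
catalan⋆centralBinomialO =
  recurrence-unique (λ n x → ℕ→ℚ (4 ℕ.* suc n) * x + (B (suc n) + BO (suc n))) refl convolution-rec closed-rec
  where
  B BO : ℕ → ℚ
  B = centralBinomialℚ
  BO = centralBinomialO
  convolution-rec : ∀ n → ℕ→ℚ (2 ℕ.+ n) * (catalan ⋆ BO) (suc n)
                          ≡ ℕ→ℚ (4 ℕ.* suc n) * (catalan ⋆ BO) n + (B (suc n) + BO (suc n))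
  convolution-rec n = begin
    ℕ→ℚ (2 ℕ.+ n) * (catalan ⋆ BO) (suc n)
      ≡⟨ ⋆-recurrence refl catalan-suc centralBinomialO-suc n ⟩
    ℕ→ℚ (4 ℕ.* suc n) * (catalan ⋆ BO) n + (catalan ⋆ (λ k → ℕ→ℚ 2 * B k)) n + BO (suc n)
      ≡⟨ cong (λ x → ℕ→ℚ (4 ℕ.* suc n) * (catalan ⋆ BO) n + x + BO (suc n))
              (trans (⋆-*ʳ catalan B (ℕ→ℚ 2) n) (cong (ℕ→ℚ 2 *_) (catalan⋆centralBinomialℚ n))) ⟩
    ℕ→ℚ (4 ℕ.* suc n) * (catalan ⋆ BO) n + ℕ→ℚ 2 * (½ * B (suc n)) + BO (suc n)
      ≡⟨ double-half (ℕ→ℚ (4 ℕ.* suc n) * (catalan ⋆ BO) n) (B (suc n)) (BO (suc n)) ⟩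
    ℕ→ℚ (4 ℕ.* suc n) * (catalan ⋆ BO) n + (B (suc n) + BO (suc n)) ∎
    where
    double-half : ∀ a b d → a + ℕ→ℚ 2 * (½ * b) + d ≡ a + (b + d)
    double-half = solve-∀ ℚ-ring
  closed-rec : ∀ n → ℕ→ℚ (2 ℕ.+ n) * (½ * BO (2 ℕ.+ n) - + (4 ^ suc n) / suc (suc n))
                     ≡ ℕ→ℚ (4 ℕ.* suc n) * (½ * BO (suc n) - + (4 ^ n) / suc n) + (B (suc n) + BO (suc n))
  closed-rec n = begin
    ℕ→ℚ (2 ℕ.+ n) * (½ * BO (2 ℕ.+ n) - P (suc n))
      ≡⟨ distribute (ℕ→ℚ (2 ℕ.+ n)) (BO (2 ℕ.+ n)) (P (suc n)) ⟩
    ½ * (ℕ→ℚ (2 ℕ.+ n) * BO (2 ℕ.+ n)) - ℕ→ℚ (2 ℕ.+ n) * P (suc n)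
      ≡⟨ cong₂ (λ x y → ½ * x - y) (centralBinomialO-suc (suc n)) (4^n/[1+n]-rec n) ⟩
    ½ * (ℕ→ℚ (centralRatio (suc n)) * BO (suc n) + ℕ→ℚ 2 * B (suc n)) - ℕ→ℚ (4 ℕ.* suc n) * P n
      ≡⟨ cong (λ x → ½ * (x * BO (suc n) + ℕ→ℚ 2 * B (suc n)) - ℕ→ℚ (4 ℕ.* suc n) * P n) (centralRatio-suc n) ⟩
    ½ * ((ℕ→ℚ (4 ℕ.* suc n) + ℕ→ℚ 2) * BO (suc n) + ℕ→ℚ 2 * B (suc n)) - ℕ→ℚ (4 ℕ.* suc n) * P n
      ≡⟨ collect (ℕ→ℚ (4 ℕ.* suc n)) (BO (suc n)) (B (suc n)) (P n) ⟩
    ℕ→ℚ (4 ℕ.* suc n) * (½ * BO (suc n) - P n) + (B (suc n) + BO (suc n)) ∎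
    where
    P : ℕ → ℚ
    P n = + (4 ^ n) / suc n
    distribute : ∀ x d p → x * (½ * d - p) ≡ ½ * (x * d) - x * p
    distribute = solve-∀ ℚ-ring
    collect : ∀ a d b p → ½ * ((a + ℕ→ℚ 2) * d + ℕ→ℚ 2 * b) - a * p ≡ a * (½ * d - p) + (b + d)
    collect = solve-∀ ℚ-ring

corollary3 : (n : ℕ) →
    sumTo n (λ j → ℕ→ℚ ((2 ℕ.* (n ∸ j)) C (n ∸ j)) * catalan j * O (n ∸ j))
      ≡ ½ * ℕ→ℚ ((2 ℕ.* suc n) C suc n) * O (suc n) - (+ (4 ^ n)) / suc n
corollary3 n = begin
  sumTo n (λ j → centralBinomialℚ (n ∸ j) * catalan j * O (n ∸ j))
    ≡⟨ sumTo-cong n (λ {j} _ → reorder (centralBinomialℚ (n ∸ j)) (catalan j) (O (n ∸ j))) ⟩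
  (catalan ⋆ centralBinomialO) n
    ≡⟨ catalan⋆centralBinomialO n ⟩
  ½ * centralBinomialO (suc n) - + (4 ^ n) / suc n
    ≡⟨ cong (_- + (4 ^ n) / suc n) (*-assoc ½ (centralBinomialℚ (suc n)) (O (suc n))) ⟨
  ½ * centralBinomialℚ (suc n) * O (suc n) - + (4 ^ n) / suc n ∎
  where
  reorder : ∀ b c o → b * c * o ≡ c * (b * o)
  reorder = solve-∀ ℚ-ring
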